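{- If all item values of a $\mathsf{BarterSV}$ instance are equal, then $\mathsf{BarterSV\text{ - }LP}$ is integral.
   Context: A $\mathsf{BarterSV}$ instance: agents $[n]$, items $\mathcal{I}$ with values $v_j>0$, have-lists $H_i$, wishlists $W_i$, utilities $w(i,i',j)\in\mathbb{R}$. Its bipartite graph $(L,R,E)$: $L_i=\{\ell_{ij}:j\in H_i\}$, $R_i=\{r_{ij}:j\in W_i\}$, $L=\dot\bigcup L_i$, $R=\dot\bigcup R_i$, vertex values $v_{\ell_{ij}}=v_{r_{ij}}=v_j$, edges $E=\{(\ell_{ij},r_{i'j}):j\in H_i\cap W_{i'}\}$, weights $w_{(\ell_{ij},r_{i'j})}=w(i,i',j)$; $x(a)=\sum_{e\ni a}x_e$. $\mathsf{BarterSV\text{ - }LP}$: maximize $\sum_e w_ex_e$ subject to $x(a)\le1$ for all $a\in L\cup R$, $\sum_{a\in L_i}x(a)v_a=\sum_{b\in R_i}x(b)v_b$ for all $i$, $x_e\ge0$. Integral means its feasible region is the convex hull of its integral feasible points (equivalently, it has an integral optimal solution for every choice of weights).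
   Formalization: The item values $v_j$ and the utilities are rational instead of real, and the LP points and the weights of convex combinations are taken over ℚ. -}

module Defs where

open import Data.Nat using (ℕ; zero; suc)
open import Data.Fin using (Fin; zero; suc)
open import Data.Bool using (Bool; true; false; if_then_else_; _∧_; T)
open import Data.Integer using (ℤ)
open import Data.Rational using (ℚ; 0ℚ; 1ℚ; _+_; _*_; _≤_; _<_; _/_)
open import Data.Product using (Σ; ∃; _×_)
open import Relation.Binary.PropositionalEquality using (_≡_)
open import Relation.Nullary using (¬_)

Σ[_] : (k : ℕ) → (Fin k → ℚ) → ℚ
Σ[ zero ] f = 0ℚ
Σ[ suc k ] f = f zero + Σ[ k ] (λ t → f (suc t))

-- A BarterSV instance with n agents and m items (items = Fin m).
-- have i j = true  iff  j ∈ H_i ;  wish i j = true  iff  j ∈ W_i.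
record BarterSV (n m : ℕ) : Set where
  field
    value     : Fin m → ℚ
    value-pos : ∀ j → 0ℚ < value j
    have      : Fin n → Fin m → Bool
    wish      : Fin n → Fin m → Bool
    util      : Fin n → Fin n → Fin m → ℚ

module _ {n m : ℕ} (I : BarterSV n m) where
  open BarterSV I

  -- The edge (ℓ_ij , r_i'j) exists iff j ∈ H_i ∩ W_i'.
  IsEdge : Fin n → Fin n → Fin m → Set
  IsEdge i i' j = T (have i j ∧ wish i' j)

  -- Points of ℚ^E, represented as functions on triples (i , i' , j) that
  -- vanish on non-edges (see Feasible, Support).
  Point : Set
  Point = Fin n → Fin n → Fin m → ℚ

  xL : Point → Fin n → Fin m → ℚ
  xL x i j = Σ[ n ] (λ i' → x i i' j)

  xR : Point → Fin n → Fin m → ℚ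
  xR x i' j = Σ[ n ] (λ i → x i i' j)

  Support : Point → Set
  Support x = ∀ i i' j → ¬ IsEdge i i' j → x i i' j ≡ 0ℚ

  Feasible : Point → Set
  Feasible x =
      Support x
    × (∀ i i' j → IsEdge i i' j → 0ℚ ≤ x i i' j)
    × (∀ i j → T (have i j) → xL x i j ≤ 1ℚ)
    × (∀ i j → T (wish i j) → xR x i j ≤ 1ℚ)
    × (∀ i → Σ[ m ] (λ j → if have i j then xL x i j * value j else 0ℚ)
           ≡ Σ[ m ] (λ j → if wish i j then xR x i j * value j else 0ℚ))

  IsIntegralPoint : Point → Set
  IsIntegralPoint x = ∀ i i' j → ∃ λ (z : ℤ) → x i i' j ≡ z / 1

  InIntegralHull : Point → Set
  InIntegralHull x =
    Σ ℕ λ k → Σ (Fin k → ℚ) λ μ → Σ (Fin k → Point) λ p →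
        (∀ t → 0ℚ ≤ μ t)
      × (Σ[ k ] μ ≡ 1ℚ)
      × (∀ t → Feasible (p t) × IsIntegralPoint (p t))
      × (∀ i i' j → x i i' j ≡ Σ[ k ] (λ t → μ t * p t i i' j))

  LPIntegral : Set
  LPIntegral = ∀ (x : Point) → (Feasible x → InIntegralHull x) × (InIntegralHull x → Feasible x)

AllValuesEqual : ∀ {n m} → BarterSV n m → Set
AllValuesEqual I = ∀ j j' → BarterSV.value I j ≡ BarterSV.value I j'

-- With equal item values the value-balance constraint of agent i reduces to
-- Σ_{a ∈ Lᵢ} x(a) = Σ_{b ∈ Rᵢ} x(b), so BarterSV-LP describes the circulations with values
-- in [0,1] on the network obtained by directing E from L to R and adding arcs i → ℓᵢⱼ and
-- rᵢⱼ → i. At a vertex touched by an arc of fractional flow the inflow equals the outflow,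
-- so another incident arc carries fractional flow as well; hence the fractional arcs
-- contain a cycle. Pushing flow around that cycle in either direction until a further arc
-- becomes integral writes x as a convex combination of two feasible points with fewer
-- fractional arcs, and induction on that number puts x in the hull of the integral
-- feasible points. The converse inclusion is convexity of the feasible region.

module Submission where

open import Defs
open import Algebra.Bundles using (module CommutativeMonoid)
open import Data.Bool using (true; false; T; if_then_else_; _∧_)
open import Data.Bool.Properties using (T-∧; T?)
open import Data.Empty using (⊥-elim)
open import Data.Fin using (Fin; zero; suc; splitAt)
open import Data.Fin.Instances
import Data.Fin.Properties as Fin
open import Data.Integer as ℤ using (ℤ; +[1+_]; -[1+_])
import Data.Integer.Properties as ℤ
open import Data.List using (List; []; _∷_; length; filter; map; allFin; cartesianProduct)
import Data.List as List
open import Data.List.Membership.Propositional using (_∈_; _∉_)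
open import Data.List.Membership.Propositional.Properties
  using (∈-map⁺; ∈-++⁺ˡ; ∈-++⁺ʳ; ∈-allFin; ∈-cartesianProduct⁺; ∈-filter⁺; ∈-filter⁻)
open import Data.List.Properties using (length-removeAt′)
open import Data.List.Relation.Unary.All using ([]; _∷_)
import Data.List.Relation.Unary.All as All
open import Data.List.Relation.Unary.All.Properties using (¬Any⇒All¬; All¬⇒¬Any; ¬All⇒Any¬)
open import Data.List.Relation.Unary.Any using (here; there; _─_)
import Data.List.Relation.Unary.Any as Any
open import Data.List.Relation.Unary.Unique.Propositional using (Unique; []; _∷_)
open import Data.Nat as ℕ using (ℕ; zero; suc; z≤n; s≤s)
import Data.Nat.Coprimality as Coprime
import Data.Nat.Properties as ℕ
open import Data.Product using (Σ; ∃; _×_; _,_; proj₁; proj₂; uncurry)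
open import Data.Product.Instances
open import Data.Rational
open import Data.Rational.Properties
open import Data.Rational.Solver using (module +-*-Solver)
open import Data.Sum using (_⊎_; inj₁; inj₂)
open import Data.Sum.Instances
open import Data.Sum.Properties using ([,]-map)
open import Data.Vec.Functional using (_++_)
open import Data.Vec.Functional.Relation.Unary.All.Properties using (++⁺)
open import Function using (_∘_; _⇔_; mk⇔; Equivalence)
open import Relation.Binary.Bundles using (DecTotalOrder)
open import Relation.Binary.Definitions using (DecidableEquality; tri<; tri≈; tri>)
open import Relation.Binary.PropositionalEquality
import Relation.Binary.TypeClasses as TypeClasses
open import Relation.Nullary using (¬_; Dec; yes; no; does; ¬?; _×-dec_)
open import Relation.Nullary.Decidable using (decidable-stable)
open import Relation.Unary using (Decidable)

open import Algebra.Properties.AbelianGroup +-0-abelianGroup using (xyx⁻¹≈y)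
open import Algebra.Properties.CommutativeSemigroup (CommutativeMonoid.commutativeSemigroup +-0-commutativeMonoid)
  using (interchange)
open import Algebra.Properties.Group +-0-group using (x∙y⁻¹≈ε⇒x≈y)
open import Data.List.Extrema (DecTotalOrder.totalOrder ≤-decTotalOrder) using (argmin; f[argmin]≤f[xs]; argmin-all)
open +-*-Solver

Integral : ℚ → Set
Integral q = ∃ λ (z : ℤ) → q ≡ z / 1

private
  ι : ℤ → ℚ
  ι z = mkℚ z 0 (Coprime.sym (Coprime.1-coprimeTo _))

  z/1≡ι : ∀ z → z / 1 ≡ ι z
  z/1≡ι z = ↥p/↧p≡p (ι z)

  integral-ι : ∀ {q} z → q ≡ ι z → Integral q
  integral-ι z q≡ι = z , trans q≡ι (sym (z/1≡ι z))

  ι-+ : ∀ a b → ι a + ι b ≡ ι (a ℤ.+ b)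
  ι-+ a b = trans (cong₂ (λ u v → (u ℤ.+ v) / 1) (ℤ.*-identityʳ a) (ℤ.*-identityʳ b)) (z/1≡ι (a ℤ.+ b))

  ι-neg : ∀ a → - ι a ≡ ι (ℤ.- a)
  ι-neg (ℤ.+ zero) = refl
  ι-neg +[1+ n ] = refl
  ι-neg -[1+ n ] = refl

integral-0 : Integral 0ℚ
integral-0 = ℤ.0ℤ , refl

integral-1 : Integral 1ℚ
integral-1 = ℤ.1ℤ , refl

integral-+ : ∀ {p q} → Integral p → Integral q → Integral (p + q)
integral-+ (a , refl) (b , refl) = integral-ι (a ℤ.+ b) (trans (cong₂ _+_ (z/1≡ι a) (z/1≡ι b)) (ι-+ a b))

integral-neg : ∀ {p} → Integral p → Integral (- p)
integral-neg (a , refl) = integral-ι (ℤ.- a) (trans (cong -_ (z/1≡ι a)) (ι-neg a))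

integral-difference : ∀ {p q} → Integral p → Integral q → Integral (p - q)
integral-difference ip iq = integral-+ ip (integral-neg iq)

integral? : ∀ q → Dec (Integral q)
integral? (mkℚ z zero _) = yes (z , sym (z/1≡ι z))
integral? (mkℚ z (suc d) _) = no λ (w , eq) → ℕ.1+n≢0 (cong ℚ.denominator-1 (trans eq (z/1≡ι w)))

Σ-cong : ∀ k {f g : Fin k → ℚ} → (∀ t → f t ≡ g t) → Σ[ k ] f ≡ Σ[ k ] g
Σ-cong zero    f≗g = refl
Σ-cong (suc k) f≗g = cong₂ _+_ (f≗g zero) (Σ-cong k (f≗g ∘ suc))

Σ-zero : ∀ k → Σ[ k ] (λ _ → 0ℚ) ≡ 0ℚ
Σ-zero zero    = refl
Σ-zero (suc k) = trans (+-identityˡ _) (Σ-zero k)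

Σ-distrib-+ : ∀ k (f g : Fin k → ℚ) → Σ[ k ] (λ t → f t + g t) ≡ Σ[ k ] f + Σ[ k ] g
Σ-distrib-+ zero    f g = refl
Σ-distrib-+ (suc k) f g = trans (cong ((f zero + g zero) +_) (Σ-distrib-+ k (f ∘ suc) (g ∘ suc)))
                                (interchange (f zero) (g zero) _ _)

*-distribˡ-Σ : ∀ k c (f : Fin k → ℚ) → Σ[ k ] (λ t → c * f t) ≡ c * Σ[ k ] f
*-distribˡ-Σ zero    c f = sym (*-zeroʳ c)
*-distribˡ-Σ (suc k) c f = trans (cong (c * f zero +_) (*-distribˡ-Σ k c (f ∘ suc))) (sym (*-distribˡ-+ c _ _))

neg-distrib-Σ : ∀ k (f : Fin k → ℚ) → Σ[ k ] (λ t → - f t) ≡ - Σ[ k ] f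
neg-distrib-Σ zero    f = refl
neg-distrib-Σ (suc k) f = trans (cong (- f zero +_) (neg-distrib-Σ k (f ∘ suc))) (sym (neg-distrib-+ (f zero) _))

Σ-comm : ∀ a b (f : Fin a → Fin b → ℚ) →
         Σ[ a ] (λ s → Σ[ b ] (f s)) ≡ Σ[ b ] (λ t → Σ[ a ] (λ s → f s t))
Σ-comm zero    b f = sym (Σ-zero b)
Σ-comm (suc a) b f = trans (cong (Σ[ b ] (f zero) +_) (Σ-comm a b (f ∘ suc)))
                           (sym (Σ-distrib-+ b (f zero) _))

Σ-mono-≤ : ∀ k {f g : Fin k → ℚ} → (∀ t → f t ≤ g t) → Σ[ k ] f ≤ Σ[ k ] g
Σ-mono-≤ zero    f≤g = ≤-refl
Σ-mono-≤ (suc k) f≤g = +-mono-≤ (f≤g zero) (Σ-mono-≤ k (f≤g ∘ suc))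

Σ-nonNeg : ∀ k {f : Fin k → ℚ} → (∀ t → 0ℚ ≤ f t) → 0ℚ ≤ Σ[ k ] f
Σ-nonNeg k {f} f≥0 = subst (_≤ Σ[ k ] f) (Σ-zero k) (Σ-mono-≤ k f≥0)

term≤Σ : ∀ k {f : Fin k → ℚ} → (∀ t → 0ℚ ≤ f t) → ∀ t₀ → f t₀ ≤ Σ[ k ] f
term≤Σ (suc k) {f} f≥0 zero     =
  subst (_≤ Σ[ suc k ] f) (+-identityʳ (f zero)) (+-monoʳ-≤ (f zero) (Σ-nonNeg k (f≥0 ∘ suc)))
term≤Σ (suc k) {f} f≥0 (suc t₀) =
  subst (_≤ Σ[ suc k ] f) (+-identityˡ (f (suc t₀))) (+-mono-≤ (f≥0 zero) (term≤Σ k (f≥0 ∘ suc) t₀))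

Σ-single : ∀ k {f : Fin k → ℚ} t₀ → (∀ t → t ≢ t₀ → f t ≡ 0ℚ) → Σ[ k ] f ≡ f t₀
Σ-single (suc k) {f} zero     f≡0 =
  trans (cong (f zero +_) (trans (Σ-cong k (λ t → f≡0 (suc t) λ ())) (Σ-zero k))) (+-identityʳ _)
Σ-single (suc k) {f} (suc t₀) f≡0 =
  trans (cong (_+ Σ[ k ] (f ∘ suc)) (f≡0 zero λ ()))
        (trans (+-identityˡ _) (Σ-single k t₀ (λ t t≢t₀ → f≡0 (suc t) (t≢t₀ ∘ Fin.suc-injective))))

Σ-+-* : ∀ k (f g : Fin k → ℚ) s → Σ[ k ] (λ t → f t + s * g t) ≡ Σ[ k ] f + s * Σ[ k ] g
Σ-+-* k f g s = trans (Σ-distrib-+ k f (λ t → s * g t)) (cong (Σ[ k ] f +_) (*-distribˡ-Σ k s g))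

Σ-comm-*ˡ : ∀ a k (μ : Fin k → ℚ) (f : Fin a → Fin k → ℚ) →
            Σ[ a ] (λ s → Σ[ k ] (λ t → μ t * f s t)) ≡ Σ[ k ] (λ t → μ t * Σ[ a ] (λ s → f s t))
Σ-comm-*ˡ a k μ f = trans (Σ-comm a k _) (Σ-cong k (λ t → *-distribˡ-Σ a (μ t) (λ s → f s t)))

*-distribʳ-Σ : ∀ k c (f : Fin k → ℚ) → Σ[ k ] (λ t → f t * c) ≡ Σ[ k ] f * c
*-distribʳ-Σ k c f = trans (Σ-cong k (λ t → *-comm (f t) c)) (trans (*-distribˡ-Σ k c f) (*-comm c _))

Σ-equally-weighted : ∀ k (v : Fin k → ℚ) → (∀ j j′ → v j ≡ v j′) → (∀ j → 0ℚ < v j) → ∀ f g →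
                     Σ[ k ] (λ j → f j * v j) ≡ Σ[ k ] (λ j → g j * v j) ⇔ Σ[ k ] f ≡ Σ[ k ] g
Σ-equally-weighted zero    v _     _   f g = mk⇔ (λ _ → refl) (λ _ → refl)
Σ-equally-weighted (suc k) v equal pos f g = mk⇔
  (λ eq → *-cancelʳ-≡ (trans (sym (weighted f)) (trans eq (weighted g))))
  (λ eq → trans (weighted f) (trans (cong (_* v zero) eq) (sym (weighted g))))
  where
  instance _ = positive (pos zero)
  weighted : ∀ h → Σ[ suc k ] (λ j → h j * v j) ≡ Σ[ suc k ] h * v zero
  weighted h = trans (Σ-cong (suc k) (λ j → cong (h j *_) (equal j zero))) (*-distribʳ-Σ (suc k) (v zero) h)
  *-cancelʳ-≡ : ∀ {p q} → p * v zero ≡ q * v zero → p ≡ q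
  *-cancelʳ-≡ eq = ≤-antisym (*-cancelʳ-≤-pos (v zero) (≤-reflexive eq))
                             (*-cancelʳ-≤-pos (v zero) (≤-reflexive (sym eq)))

Σ-∘-++ : ∀ {A : Set} k₁ {k₂} (h : A → ℚ) (f : Fin k₁ → A) (g : Fin k₂ → A) →
         Σ[ k₁ ℕ.+ k₂ ] (h ∘ (f ++ g)) ≡ Σ[ k₁ ] (h ∘ f) + Σ[ k₂ ] (h ∘ g)
Σ-∘-++ zero     h f g = sym (+-identityˡ _)
Σ-∘-++ (suc k₁) h f g = trans
  (cong (h (f zero) +_) (trans (Σ-cong _ (λ t → cong h ([,]-map (splitAt k₁ t)))) (Σ-∘-++ k₁ h (f ∘ suc) g)))
  (sym (+-assoc (h (f zero)) _ _))

integral-Σ : ∀ k {f : Fin k → ℚ} → (∀ t → Integral (f t)) → Integral (Σ[ k ] f)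
integral-Σ zero    _   = integral-0
integral-Σ (suc k) int = integral-+ (int zero) (integral-Σ k (int ∘ suc))

integral-Σ-except : ∀ k {f : Fin k → ℚ} t₀ → (∀ t → t ≢ t₀ → Integral (f t)) →
                    Integral (Σ[ k ] f) → Integral (f t₀)
integral-Σ-except (suc k) {f} zero     int intΣ =
  subst Integral (xyx⁻¹≈y (Σ[ k ] (f ∘ suc)) (f zero))
    (integral-difference (subst Integral (+-comm (f zero) _) intΣ)
                         (integral-Σ k (λ t → int (suc t) λ ())))
integral-Σ-except (suc k) {f} (suc t₀) int intΣ =
  integral-Σ-except k t₀ (λ t t≢t₀ → int (suc t) (t≢t₀ ∘ Fin.suc-injective))
    (subst Integral (xyx⁻¹≈y (f zero) (Σ[ k ] (f ∘ suc))) (integral-difference intΣ (int zero λ ())))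

nonintegral-partner : ∀ k {k′} (f : Fin k → ℚ) (g : Fin k′ → ℚ) → Σ[ k ] f ≡ Σ[ k′ ] g →
                      ∀ t₀ → ¬ Integral (f t₀) →
                      (∃ λ t → t ≢ t₀ × ¬ Integral (f t)) ⊎ (∃ λ t → ¬ Integral (g t))
nonintegral-partner k {k′} f g Σf≡Σg t₀ frac
  with Fin.any? (λ t → ¬? (t Fin.≟ t₀) ×-dec ¬? (integral? (f t)))
     | Fin.any? (λ t → ¬? (integral? (g t)))
... | yes found | _         = inj₁ found
... | no _      | yes found = inj₂ found
... | no none-f | no none-g =
  ⊥-elim (frac (integral-Σ-except k t₀ int-f (subst Integral (sym Σf≡Σg) (integral-Σ k′ int-g))))
  where
  int-f : ∀ t → t ≢ t₀ → Integral (f t)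
  int-f t t≢t₀ = decidable-stable (integral? (f t)) λ frac-t → none-f (t , t≢t₀ , frac-t)
  int-g : ∀ t → Integral (g t)
  int-g t = decidable-stable (integral? (g t)) λ frac-t → none-g (t , frac-t)

-- The unit interval and hitting times

0≤*0≤ : ∀ {p q} → 0ℚ ≤ p → 0ℚ ≤ q → 0ℚ ≤ p * q
0≤*0≤ {p} {q} 0≤p 0≤q = nonNegative⁻¹ _ {{nonNeg*nonNeg⇒nonNeg p {{nonNegative 0≤p}} q {{nonNegative 0≤q}}}}

p+t*0≡p : ∀ p t {c} → c ≡ 0ℚ → p + t * c ≡ p
p+t*0≡p p t refl = trans (cong (p +_) (*-zeroʳ t)) (+-identityʳ p)

In[0,1] : ℚ → Set
In[0,1] q = 0ℚ ≤ q × q ≤ 1ℚ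

In[0,1]-complement : ∀ {q} → In[0,1] q → In[0,1] (1ℚ - q)
In[0,1]-complement {q} (0≤q , q≤1) =
  subst (_≤ 1ℚ - q) (+-inverseʳ 1ℚ) (+-monoʳ-≤ 1ℚ (neg-antimono-≤ q≤1)) ,
  subst (1ℚ - q ≤_) (+-identityʳ 1ℚ) (+-monoʳ-≤ 1ℚ (neg-antimono-≤ 0≤q))

nonintegral-interior : ∀ {q} → In[0,1] q → ¬ Integral q → 0ℚ < q × q < 1ℚ
nonintegral-interior (0≤q , q≤1) frac =
  ≤∧≢⇒< 0≤q (λ 0≡q → frac (subst Integral 0≡q integral-0)) ,
  ≤∧≢⇒< q≤1 (λ q≡1 → frac (subst Integral (sym q≡1) integral-1))
  where
  ≤∧≢⇒< : ∀ {p q} → p ≤ q → p ≢ q → p < q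
  ≤∧≢⇒< {p} {q} p≤q p≢q with <-cmp p q
  ... | tri< p<q _ _ = p<q
  ... | tri≈ _ p≡q _ = ⊥-elim (p≢q p≡q)
  ... | tri> _ _ q<p = ⊥-elim (<-irrefl refl (≤-<-trans p≤q q<p))

convex-In[0,1] : ∀ k (μ q : Fin k → ℚ) → (∀ t → 0ℚ ≤ μ t) → Σ[ k ] μ ≡ 1ℚ →
                 (∀ t → In[0,1] (q t)) → In[0,1] (Σ[ k ] (λ t → μ t * q t))
convex-In[0,1] k μ q μ≥0 Σμ≡1 q∈ =
  Σ-nonNeg k (λ t → 0≤*0≤ (μ≥0 t) (proj₁ (q∈ t))) ,
  subst (Σ[ k ] (λ t → μ t * q t) ≤_) (trans (Σ-cong k (λ t → *-identityʳ (μ t))) Σμ≡1)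
    (Σ-mono-≤ k (λ t → *-monoˡ-≤-nonNeg (μ t) {{nonNegative (μ≥0 t)}} (proj₂ (q∈ t))))

record HitTime (a c r : ℚ) : Set where
  field
    time>0   : 0ℚ < r
    lands    : Integral (a + r * c)
    stays    : ∀ t → 0ℚ ≤ t → t ≤ r → In[0,1] (a + t * c)

risingHitTime : (a c : ℚ) → 0ℚ < c → ℚ
risingHitTime a c 0<c = (1ℚ - a) * (1/ c) {{pos⇒nonZero c {{positive 0<c}}}}

risingHitTime-spec : ∀ {a c} → 0ℚ ≤ a → a < 1ℚ → (0<c : 0ℚ < c) → HitTime a c (risingHitTime a c 0<c)
risingHitTime-spec {a} {c} 0≤a a<1 0<c = record
  { time>0 = positive⁻¹ r {{pos*pos⇒pos (1ℚ - a) {{positive 0<1-a}} (1/ c) {{1/pos⇒pos c}}}}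
  ; lands  = subst Integral (sym hits-1) integral-1
  ; stays  = λ t 0≤t t≤r → ≤-trans 0≤a (a≤a+tc t 0≤t) ,
                            subst (a + t * c ≤_) hits-1 (+-monoʳ-≤ a (*-monoʳ-≤-nonNeg c {{pos⇒nonNeg c}} t≤r))
  }
  where
  instance _ = positive 0<c
  instance _ = pos⇒nonZero c
  r = risingHitTime a c 0<c
  0<1-a : 0ℚ < 1ℚ - a
  0<1-a = subst (_< 1ℚ - a) (+-inverseʳ a) (+-monoˡ-< (- a) a<1)
  hits-1 : a + r * c ≡ 1ℚ
  hits-1 = begin
    a + (1ℚ - a) * 1/ c * c   ≡⟨ cong (a +_) (*-assoc (1ℚ - a) (1/ c) c) ⟩
    a + (1ℚ - a) * (1/ c * c) ≡⟨ cong (λ u → a + (1ℚ - a) * u) (*-inverseˡ c) ⟩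
    a + (1ℚ - a) * 1ℚ         ≡⟨ solve 1 (λ a → a :+ (con 1ℚ :- a) :* con 1ℚ := con 1ℚ) refl a ⟩
    1ℚ                        ∎
    where open ≡-Reasoning
  a≤a+tc : ∀ t → 0ℚ ≤ t → a ≤ a + t * c
  a≤a+tc t 0≤t = subst (_≤ a + t * c) (+-identityʳ a) (+-monoʳ-≤ a (0≤*0≤ 0≤t (<⇒≤ 0<c)))

HitTime-reflect : ∀ {a c r} → HitTime (1ℚ - a) (- c) r → HitTime a c r
HitTime-reflect {a} {c} {r} h = record
  { time>0 = time>0
  ; lands  = subst Integral (sym (mirror r)) (integral-difference integral-1 lands)
  ; stays  = λ t 0≤t t≤r → subst In[0,1] (sym (mirror t)) (In[0,1]-complement (stays t 0≤t t≤r))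
  }
  where
  open HitTime h
  mirror : ∀ t → a + t * c ≡ 1ℚ - ((1ℚ - a) + t * (- c))
  mirror t = solve 3 (λ a t c → a :+ t :* c := con 1ℚ :- ((con 1ℚ :- a) :+ t :* (:- c))) refl a t c

-- The first t > 0 at which a + t * c reaches 0 or 1; the junk value 0 when c = 0.
hitTime : ℚ → ℚ → ℚ
hitTime a c with <-cmp c 0ℚ
... | tri< c<0 _ _ = risingHitTime (1ℚ - a) (- c) (neg-antimono-< c<0)
... | tri≈ _ _ _   = 0ℚ
... | tri> _ _ 0<c = risingHitTime a c 0<c

hitTime-spec : ∀ {a c} → 0ℚ < a → a < 1ℚ → c ≢ 0ℚ → HitTime a c (hitTime a c)
hitTime-spec {a} {c} 0<a a<1 c≢0 with <-cmp c 0ℚ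
... | tri< c<0 _ _ = HitTime-reflect (risingHitTime-spec (proj₁ (In[0,1]-complement (<⇒≤ 0<a , <⇒≤ a<1)))
                                        (subst (1ℚ - a <_) (+-identityʳ 1ℚ) (+-monoʳ-< 1ℚ (neg-antimono-< 0<a)))
                                        (neg-antimono-< c<0))
... | tri≈ _ c≡0 _ = ⊥-elim (c≢0 c≡0)
... | tri> _ _ 0<c = risingHitTime-spec (<⇒≤ 0<a) a<1 0<c

module _ {A : Set} where

  ∈-─ : ∀ {x y : A} {ys} (x∈ys : x ∈ ys) → y ∈ ys → y ≢ x → y ∈ (ys ─ x∈ys)
  ∈-─ (here refl) (here refl) y≢x = ⊥-elim (y≢x refl)
  ∈-─ (here _)    (there y∈)  _   = y∈
  ∈-─ (there _)   (here y≡)   _   = here y≡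
  ∈-─ (there x∈)  (there y∈)  y≢x = there (∈-─ x∈ y∈ y≢x)

  Unique⇒length≤ : ∀ {xs ys : List A} → Unique xs → (∀ {x} → x ∈ xs → x ∈ ys) → length xs ℕ.≤ length ys
  Unique⇒length≤ {[]}     _               _     = z≤n
  Unique⇒length≤ {x ∷ xs} {ys} (x∉xs ∷ uxs) xs⊆ys =
    subst (suc (length xs) ℕ.≤_) (sym (length-removeAt′ ys _))
      (s≤s (Unique⇒length≤ uxs λ y∈xs → ∈-─ x∈ys (xs⊆ys (there y∈xs)) λ { refl → All¬⇒¬Any x∉xs y∈xs }))
    where x∈ys = xs⊆ys (here refl)

module _ {A : Set} {P Q : A → Set} (P? : Decidable P) (Q? : Decidable Q) (Q⇒P : ∀ {x} → Q x → P x) where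

  length-filter-mono : ∀ xs → length (filter Q? xs) ℕ.≤ length (filter P? xs)
  length-filter-mono []       = z≤n
  length-filter-mono (x ∷ xs) with Q? x | P? x
  ... | yes _ | yes _ = s≤s (length-filter-mono xs)
  ... | yes q | no ¬p = ⊥-elim (¬p (Q⇒P q))
  ... | no _  | yes _ = ℕ.m≤n⇒m≤1+n (length-filter-mono xs)
  ... | no _  | no _  = length-filter-mono xs

  length-filter-mono-< : ∀ {x xs} → x ∈ xs → P x → ¬ Q x → length (filter Q? xs) ℕ.< length (filter P? xs)
  length-filter-mono-< {x} {_ ∷ xs} (here refl) px ¬qx with Q? x | P? x
  ... | yes qx | _     = ⊥-elim (¬qx qx)
  ... | no _   | no ¬p = ⊥-elim (¬p px)
  ... | no _   | yes _ = s≤s (length-filter-mono xs)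
  length-filter-mono-< {xs = y ∷ xs} (there x∈) px ¬qx with Q? y | P? y
  ... | yes _ | yes _ = s≤s (length-filter-mono-< x∈ px ¬qx)
  ... | yes q | no ¬p = ⊥-elim (¬p (Q⇒P q))
  ... | no _  | yes _ = ℕ.m<n⇒m<1+n (length-filter-mono-< x∈ px ¬qx)
  ... | no _  | no _  = length-filter-mono-< x∈ px ¬qx

Enumeration : Set → Set
Enumeration A = Σ (List A) λ xs → ∀ x → x ∈ xs

enum-Fin : ∀ k → Enumeration (Fin k)
enum-Fin k = allFin k , ∈-allFin

enum-× : ∀ {A B} → Enumeration A → Enumeration B → Enumeration (A × B)
enum-× (xs , ∈xs) (ys , ∈ys) = cartesianProduct xs ys , λ (x , y) → ∈-cartesianProduct⁺ (∈xs x) (∈ys y)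

enum-⊎ : ∀ {A B} → Enumeration A → Enumeration B → Enumeration (A ⊎ B)
enum-⊎ (xs , ∈xs) (ys , ∈ys) = map inj₁ xs List.++ map inj₂ ys , λ
  { (inj₁ x) → ∈-++⁺ˡ (∈-map⁺ inj₁ (∈xs x))
  ; (inj₂ y) → ∈-++⁺ʳ (map inj₁ xs) (∈-map⁺ inj₂ (∈ys y)) }

record Minimiser {E : Set} (P : E → Set) (r : E → ℚ) (L : List E) : Set where
  field
    arg     : E
    arg-P   : P arg
    minimal : ∀ {e} → e ∈ L → P e → r arg ≤ r e

minimiser : ∀ {E : Set} {P : E → Set} → Decidable P → (r : E → ℚ) → ∀ {L e₀} → P e₀ → Minimiser P r L
minimiser P? r {L} {e₀} Pe₀ = record
  { arg     = argmin r e₀ (filter P? L)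
  ; arg-P   = argmin-all r {xs = filter P? L} Pe₀ (All.tabulate (proj₂ ∘ ∈-filter⁻ P? {xs = L}))
  ; minimal = λ e∈L Pe → All.lookup (f[argmin]≤f[xs] {f = r} e₀ (filter P? L)) (∈-filter⁺ P? e∈L Pe)
  }

-- Circulations in finite digraphs

record FiniteDigraph : Set₁ where
  field
    Vertex Arc     : Set
    _≟ⱽ_           : DecidableEquality Vertex
    _≟ᴬ_           : DecidableEquality Arc
    src tgt        : Arc → Vertex
    loopless       : ∀ e → src e ≢ tgt e
    vertices       : List Vertex
    ∈-vertices     : ∀ v → v ∈ vertices
    indeg outdeg   : Vertex → ℕ
    into           : ∀ v → Fin (indeg v) → Arc
    outof          : ∀ v → Fin (outdeg v) → Arc
    into-tgt       : ∀ v t → tgt (into v t) ≡ v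
    outof-src      : ∀ v t → src (outof v t) ≡ v
    into-complete  : ∀ e → ∃ λ t → into (tgt e) t ≡ e
    outof-complete : ∀ e → ∃ λ t → outof (src e) t ≡ e
    into-injective  : ∀ v {t t′} → into v t ≡ into v t′ → t ≡ t′
    outof-injective : ∀ v {t t′} → outof v t ≡ outof v t′ → t ≡ t′

module Circulation (G : FiniteDigraph) where

  open FiniteDigraph G
  open import Data.List.Membership.DecPropositional _≟ⱽ_ using (_∈?_)

  Incident : Vertex → Arc → Set
  Incident v e = src e ≡ v ⊎ tgt e ≡ v

  inflow outflow ∂ : (Arc → ℚ) → Vertex → ℚ
  inflow  f v = Σ[ indeg v ] (f ∘ into v)
  outflow f v = Σ[ outdeg v ] (f ∘ outof v)
  ∂ f v = inflow f v - outflow f v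

  IsCirculation : (Arc → ℚ) → Set
  IsCirculation f = ∀ v → inflow f v ≡ outflow f v

  -- Abstract, so that the case splits on ≟ below cannot rewrite inside χ and δ.
  abstract
    χ : Arc → Arc → ℚ
    χ e e′ = if does (e′ ≟ᴬ e) then 1ℚ else 0ℚ

    δ : Vertex → Vertex → ℚ
    δ u v = if does (u ≟ⱽ v) then 1ℚ else 0ℚ

    χ-self : ∀ e → χ e e ≡ 1ℚ
    χ-self e with e ≟ᴬ e
    ... | yes _   = refl
    ... | no e≢e = ⊥-elim (e≢e refl)

    χ-other : ∀ e e′ → e′ ≢ e → χ e e′ ≡ 0ℚ
    χ-other e e′ e′≢e with e′ ≟ᴬ e
    ... | yes e′≡e = ⊥-elim (e′≢e e′≡e)
    ... | no _    = refl

    δ-self : ∀ v → δ v v ≡ 1ℚ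
    δ-self v with v ≟ⱽ v
    ... | yes _   = refl
    ... | no v≢v = ⊥-elim (v≢v refl)

    δ-other : ∀ u v → u ≢ v → δ u v ≡ 0ℚ
    δ-other u v u≢v with u ≟ⱽ v
    ... | yes u≡v = ⊥-elim (u≢v u≡v)
    ... | no _    = refl

  Σ-χ : ∀ {k} (f : Fin k → Arc) (end : Arc → Vertex) v → (∀ t → end (f t) ≡ v) →
        (∀ e → end e ≡ v → ∃ λ t → f t ≡ e) → (∀ {t t′} → f t ≡ f t′ → t ≡ t′) →
        ∀ e → Σ[ k ] (χ e ∘ f) ≡ δ (end e) v
  Σ-χ {k} f end v f-end f-complete f-injective e with end e ≟ⱽ v
  ... | yes end≡v = let (t₀ , ft₀≡e) = f-complete e end≡v in begin
    Σ[ k ] (χ e ∘ f) ≡⟨ Σ-single k t₀ (λ t t≢t₀ → χ-other e (f t) (t≢t₀ ∘ f-injective ∘ λ ft≡e → trans ft≡e (sym ft₀≡e))) ⟩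
    χ e (f t₀)       ≡⟨ trans (cong (χ e) ft₀≡e) (χ-self e) ⟩
    1ℚ               ≡⟨ sym (trans (cong (δ (end e)) (sym end≡v)) (δ-self (end e))) ⟩
    δ (end e) v      ∎
    where open ≡-Reasoning
  ... | no end≢v =
    trans (Σ-cong k (λ t → χ-other e (f t) λ { refl → end≢v (f-end t) })) (trans (Σ-zero k) (sym (δ-other _ _ end≢v)))

  ∂-zero : ∀ v → ∂ (λ _ → 0ℚ) v ≡ 0ℚ
  ∂-zero v = trans (cong₂ _-_ (Σ-zero (indeg v)) (Σ-zero (outdeg v))) (+-inverseʳ 0ℚ)

  ∂-+χ : ∀ f e s v → ∂ (λ e′ → f e′ + s * χ e e′) v ≡ ∂ f v + s * (δ (tgt e) v - δ (src e) v)
  ∂-+χ f e s v = begin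
    ∂ (λ e′ → f e′ + s * χ e e′) v
      ≡⟨ cong₂ _-_ (Σ-+-* (indeg v) (f ∘ into v) (χ e ∘ into v) s) (Σ-+-* (outdeg v) (f ∘ outof v) (χ e ∘ outof v) s) ⟩
    (inflow f v + s * inflow (χ e) v) - (outflow f v + s * outflow (χ e) v)
      ≡⟨ cong₂ (λ p q → (inflow f v + s * p) - (outflow f v + s * q))
               (Σ-χ (into v) tgt v (into-tgt v) (λ { e refl → into-complete e }) (into-injective v) e)
               (Σ-χ (outof v) src v (outof-src v) (λ { e refl → outof-complete e }) (outof-injective v) e) ⟩
    (inflow f v + s * δ (tgt e) v) - (outflow f v + s * δ (src e) v)
      ≡⟨ solve 5 (λ p q x y s → (p :+ s :* x) :- (q :+ s :* y) := (p :- q) :+ s :* (x :- y)) refl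
                 (inflow f v) (outflow f v) (δ (tgt e) v) (δ (src e) v) s ⟩
    ∂ f v + s * (δ (tgt e) v - δ (src e) v)
      ∎
    where open ≡-Reasoning

  +χ-support : ∀ (f : Arc → ℚ) s e e′ → f e′ + s * χ e e′ ≢ 0ℚ → f e′ ≢ 0ℚ ⊎ e′ ≡ e
  +χ-support f s e e′ nonzero with e′ ≟ᴬ e
  ... | yes e′≡e = inj₂ e′≡e
  ... | no e′≢e  = inj₁ λ fe′≡0 → nonzero (begin
    f e′ + s * χ e e′ ≡⟨ cong₂ (λ p q → p + s * q) fe′≡0 (χ-other e e′ e′≢e) ⟩
    0ℚ + s * 0ℚ       ≡⟨ trans (+-identityˡ _) (*-zeroʳ s) ⟩
    0ℚ                ∎)
    where open ≡-Reasoning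

  neg-circulation : ∀ {f} → IsCirculation f → IsCirculation (-_ ∘ f)
  neg-circulation {f} circ v =
    trans (neg-distrib-Σ (indeg v) (f ∘ into v)) (trans (cong -_ (circ v)) (sym (neg-distrib-Σ (outdeg v) (f ∘ outof v))))

  record NonzeroCirculation (Active : Arc → Set) : Set where
    field
      values      : Arc → ℚ
      circulation : IsCirculation values
      supported   : ∀ e → values e ≢ 0ℚ → Active e
      nonzero     : ∃ λ e → values e ≢ 0ℚ

  reverse : ∀ {Active} → NonzeroCirculation Active → NonzeroCirculation Active
  reverse C = record
    { values      = -_ ∘ values
    ; circulation = neg-circulation {values} circulation
    ; supported   = λ e -v≢0 → supported e (-v≢0 ∘ cong (-_))
    ; nonzero     = proj₁ nonzero , proj₂ nonzero ∘ neg-injective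
    }
    where open NonzeroCirculation C

  -- Crossing e from its endpoint c to `far`; `sign` is -1 when this goes against e.
  record Traversal (c : Vertex) (e : Arc) : Set where
    field
      far       : Vertex
      sign      : ℚ
      sign≢0    : sign ≢ 0ℚ
      ∂-signed  : ∀ v → sign * (δ (tgt e) v - δ (src e) v) ≡ δ far v - δ c v
      near-inc  : Incident c e
      far-inc   : Incident far e
      endpoints : ∀ {x} → Incident x e → x ≡ far ⊎ x ≡ c

  traverse : ∀ c e → Incident c e → Traversal c e
  traverse c e (inj₁ refl) = record
    { far = tgt e ; sign = 1ℚ ; sign≢0 = λ () ; ∂-signed = λ v → *-identityˡ _
    ; near-inc = inj₁ refl ; far-inc = inj₂ refl
    ; endpoints = λ { (inj₁ refl) → inj₂ refl ; (inj₂ refl) → inj₁ refl } }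
  traverse c e (inj₂ refl) = record
    { far = src e ; sign = - 1ℚ ; sign≢0 = λ ()
    ; ∂-signed = λ v → solve 2 (λ a b → (:- con 1ℚ) :* (a :- b) := b :- a) refl (δ (tgt e) v) (δ (src e) v)
    ; near-inc = inj₂ refl ; far-inc = inj₁ refl
    ; endpoints = λ { (inj₁ refl) → inj₁ refl ; (inj₂ refl) → inj₂ refl } }

  module _ (Active : Arc → Set)
           (no-dead-end : ∀ e v → Active e → Incident v e → ∃ λ e′ → Active e′ × e′ ≢ e × Incident v e′)
           where

    -- `route u` is a unit flow from the visited vertex u to `head` along the walk so far.
    record Walk : Set where
      field
        head          : Vertex
        visited       : List Vertex
        last          : Arc
        route         : Vertex → Arc → ℚ
        unique        : Unique visited
        head∈         : head ∈ visited
        last-active   : Active last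
        last-inc      : Incident head last
        ∂-route       : ∀ u → u ∈ visited → ∀ v → ∂ (route u) v ≡ δ head v - δ u v
        route-support : ∀ u e → route u e ≢ 0ℚ →
                        Active e × src e ∈ visited × tgt e ∈ visited × (Incident head e → e ≡ last)

    module _ (s : Walk) {e′ : Arc} (e′-active : Active e′) (e′≢last : e′ ≢ Walk.last s)
             (t : Traversal (Walk.head s) e′) where
      open Walk s
      open Traversal t

      route+e′ : Vertex → Arc → ℚ
      route+e′ u e = route u e + sign * χ e′ e

      ∂-route+e′ : ∀ u → u ∈ visited → ∀ v → ∂ (route+e′ u) v ≡ δ far v - δ u v
      ∂-route+e′ u u∈ v = begin
        ∂ (route+e′ u) v                                          ≡⟨ ∂-+χ (route u) e′ sign v ⟩
        ∂ (route u) v + sign * (δ (tgt e′) v - δ (src e′) v)       ≡⟨ cong₂ _+_ (∂-route u u∈ v) (∂-signed v) ⟩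
        (δ head v - δ u v) + (δ far v - δ head v)                  ≡⟨ solve 3 (λ h u f → (h :- u) :+ (f :- h) := f :- u) refl
                                                                        (δ head v) (δ u v) (δ far v) ⟩
        δ far v - δ u v                                            ∎
        where open ≡-Reasoning

      route-e′≡0 : ∀ u → route u e′ ≡ 0ℚ
      route-e′≡0 u with route u e′ ≟ 0ℚ
      ... | yes r≡0 = r≡0
      ... | no r≢0  = ⊥-elim (e′≢last (proj₂ (proj₂ (proj₂ (route-support u e′ r≢0))) near-inc))

      close : far ∈ visited → NonzeroCirculation Active
      close far∈ = record
        { values      = route+e′ far
        ; circulation = λ v → x∙y⁻¹≈ε⇒x≈y _ _ (trans (∂-route+e′ far far∈ v) (+-inverseʳ (δ far v)))
        ; supported = supported
        ; nonzero   = e′ , λ flow≡0 → sign≢0 (trans (sym (sign≡flow)) flow≡0)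
        }
        where
        supported : ∀ e → route+e′ far e ≢ 0ℚ → Active e
        supported e nz with +χ-support (route far) sign e′ e nz
        ... | inj₁ r≢0  = proj₁ (route-support far e r≢0)
        ... | inj₂ refl = e′-active
        sign≡flow : route+e′ far e′ ≡ sign
        sign≡flow = trans (cong₂ (λ a b → a + sign * b) (route-e′≡0 far) (χ-self e′))
                          (trans (+-identityˡ _) (*-identityʳ sign))

      extend : far ∉ visited → Walk
      extend far∉ = record
        { head = far ; visited = far ∷ visited ; last = e′ ; route = route′
        ; unique = ¬Any⇒All¬ visited far∉ ∷ unique ; head∈ = here refl
        ; last-active = e′-active ; last-inc = far-inc
        ; ∂-route = ∂-route′ ; route-support = route′-support }
        where
        route′ : Vertex → Arc → ℚ
        route′ u with u ≟ⱽ far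
        ... | yes _ = λ _ → 0ℚ
        ... | no _  = route+e′ u

        ∂-route′ : ∀ u → u ∈ far ∷ visited → ∀ v → ∂ (route′ u) v ≡ δ far v - δ u v
        ∂-route′ u u∈ v with u ≟ⱽ far
        ∂-route′ u u∈          v | yes refl = trans (∂-zero v) (sym (+-inverseʳ (δ u v)))
        ∂-route′ u (here u≡)   v | no u≢    = ⊥-elim (u≢ u≡)
        ∂-route′ u (there u∈)  v | no _     = ∂-route+e′ u u∈ v

        near-or-far∈ : ∀ {x} → Incident x e′ → x ∈ far ∷ visited
        near-or-far∈ inc with endpoints inc
        ... | inj₁ refl = here refl
        ... | inj₂ refl = there head∈

        route′-support : ∀ u e → route′ u e ≢ 0ℚ →
                         Active e × src e ∈ far ∷ visited × tgt e ∈ far ∷ visited × (Incident far e → e ≡ e′)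
        route′-support u e nz with u ≟ⱽ far
        ... | yes _ = ⊥-elim (nz refl)
        ... | no _ with +χ-support (route u) sign e′ e nz
        ...   | inj₁ r≢0  = let (act , src∈ , tgt∈ , _) = route-support u e r≢0 in
                act , there src∈ , there tgt∈ ,
                λ { (inj₁ refl) → ⊥-elim (far∉ src∈) ; (inj₂ refl) → ⊥-elim (far∉ tgt∈) }
        ...   | inj₂ refl = e′-active , near-or-far∈ (inj₁ refl) , near-or-far∈ (inj₂ refl) , λ _ → refl

    start : ∀ e → Active e → Walk
    start e active = record
      { head = src e ; visited = src e ∷ [] ; last = e ; route = λ _ _ → 0ℚ
      ; unique = [] ∷ [] ; head∈ = here refl ; last-active = active ; last-inc = inj₁ refl
      ; ∂-route = λ { u (here refl) v → trans (∂-zero v) (sym (+-inverseʳ (δ u v))) }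
      ; route-support = λ _ _ nz → ⊥-elim (nz refl) }

    walk : ∀ (fuel : ℕ) (s : Walk) → length vertices ℕ.< length (Walk.visited s) ℕ.+ fuel →
           NonzeroCirculation Active
    walk zero s overflow = ⊥-elim (ℕ.<⇒≱ (subst (length vertices ℕ.<_) (ℕ.+-identityʳ _) overflow)
                                          (Unique⇒length≤ (Walk.unique s) (λ {x} _ → ∈-vertices x)))
    walk (suc fuel) s overflow with no-dead-end (Walk.last s) (Walk.head s) (Walk.last-active s) (Walk.last-inc s)
    ... | e′ , e′-active , e′≢last , inc with traverse (Walk.head s) e′ inc
    ...   | t with Traversal.far t ∈? Walk.visited s
    ...     | yes far∈ = close s e′-active e′≢last t far∈
    ...     | no far∉  = walk fuel (extend s e′-active e′≢last t far∉)
                              (subst (length vertices ℕ.<_) (ℕ.+-suc _ fuel) overflow)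

    nonzeroCirculation : ∀ e → Active e → NonzeroCirculation Active
    nonzeroCirculation e active = walk (length vertices) (start e active) (ℕ.n<1+n _)

  fractional-no-dead-end : ∀ {f} → IsCirculation f → ∀ e v → ¬ Integral (f e) → Incident v e →
                           ∃ λ e′ → ¬ Integral (f e′) × e′ ≢ e × Incident v e′
  fractional-no-dead-end {f} circ e v frac (inj₂ refl)
    with t₀ , into≡e ← into-complete e
    with nonintegral-partner (indeg v) (f ∘ into v) (f ∘ outof v) (circ v) t₀ (frac ∘ subst (Integral ∘ f) into≡e)
  ... | inj₁ (t , t≢t₀ , frac-t) =
    into v t , frac-t , (t≢t₀ ∘ into-injective v ∘ λ eq → trans eq (sym into≡e)) , inj₂ (into-tgt v t)
  ... | inj₂ (t , frac-t) =
    outof v t , frac-t , (loopless e ∘ λ eq → trans (cong src (sym eq)) (outof-src v t)) , inj₁ (outof-src v t)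
  fractional-no-dead-end {f} circ e v frac (inj₁ refl)
    with t₀ , outof≡e ← outof-complete e
    with nonintegral-partner (outdeg v) (f ∘ outof v) (f ∘ into v) (sym (circ v)) t₀ (frac ∘ subst (Integral ∘ f) outof≡e)
  ... | inj₁ (t , t≢t₀ , frac-t) =
    outof v t , frac-t , (t≢t₀ ∘ outof-injective v ∘ λ eq → trans eq (sym outof≡e)) , inj₁ (outof-src v t)
  ... | inj₂ (t , frac-t) =
    into v t , frac-t , (loopless e ∘ λ eq → sym (trans (cong tgt (sym eq)) (into-tgt v t))) , inj₂ (into-tgt v t)

  fractional-cycle : ∀ {f} → IsCirculation f → ∀ e → ¬ Integral (f e) →
                     NonzeroCirculation (λ e → ¬ Integral (f e))
  fractional-cycle {f} circ = nonzeroCirculation (λ e → ¬ Integral (f e)) (fractional-no-dead-end circ)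

-- The circulation network of an instance

module Network {n m : ℕ} (I : BarterSV n m) where

  -- `left i j` and `right i j` are the paper's ℓᵢⱼ and rᵢⱼ, present for every item j;
  -- those with j ∉ Hᵢ (resp. j ∉ Wᵢ) carry no flow by `Support`.
  Node : Set
  Node = Fin n ⊎ (Fin n × Fin m) ⊎ (Fin n × Fin m)

  pattern agent i = inj₁ i
  pattern left i j = inj₂ (inj₁ (i , j))
  pattern right i j = inj₂ (inj₂ (i , j))

  Arc : Set
  Arc = (Fin n × Fin m) ⊎ (Fin n × Fin n × Fin m) ⊎ (Fin n × Fin m)

  pattern give i j = inj₁ (i , j)
  pattern trade i i′ j = inj₂ (inj₁ (i , i′ , j))
  pattern take i j = inj₂ (inj₂ (i , j))

  src tgt : Arc → Node
  src (give i j)     = agent i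
  src (trade i i′ j) = left i j
  src (take i j)     = right i j
  tgt (give i j)     = left i j
  tgt (trade i i′ j) = right i′ j
  tgt (take i j)     = agent i

  indeg outdeg : Node → ℕ
  indeg (agent i)    = m
  indeg (left i j)   = 1
  indeg (right i j)  = n
  outdeg (agent i)   = m
  outdeg (left i j)  = n
  outdeg (right i j) = 1

  into : ∀ v → Fin (indeg v) → Arc
  into (agent i)    j = take i j
  into (left i j)   _ = give i j
  into (right i′ j) i = trade i i′ j

  outof : ∀ v → Fin (outdeg v) → Arc
  outof (agent i)   j  = give i j
  outof (left i j)  i′ = trade i i′ j
  outof (right i j) _  = take i j

  network : FiniteDigraph
  network = record
    { Vertex = Node ; Arc = Arc ; _≟ⱽ_ = TypeClasses._≟_ ; _≟ᴬ_ = TypeClasses._≟_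
    ; src = src ; tgt = tgt
    ; loopless = λ { (give _ _) () ; (trade _ _ _) () ; (take _ _) () }
    ; vertices = proj₁ nodes ; ∈-vertices = proj₂ nodes
    ; indeg = indeg ; outdeg = outdeg ; into = into ; outof = outof
    ; into-tgt = λ { (agent _) _ → refl ; (left _ _) _ → refl ; (right _ _) _ → refl }
    ; outof-src = λ { (agent _) _ → refl ; (left _ _) _ → refl ; (right _ _) _ → refl }
    ; into-complete = λ { (give _ _) → zero , refl ; (trade i _ _) → i , refl ; (take _ j) → j , refl }
    ; outof-complete = λ { (give _ j) → j , refl ; (trade _ i′ _) → i′ , refl ; (take _ _) → zero , refl }
    ; into-injective = λ { (agent _) refl → refl ; (left _ _) {zero} {zero} _ → refl ; (right _ _) refl → refl }
    ; outof-injective = λ { (agent _) refl → refl ; (left _ _) refl → refl ; (right _ _) {zero} {zero} _ → refl }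
    }
    where
    nodes : Enumeration Node
    nodes = enum-⊎ (enum-Fin n) (enum-⊎ (enum-× (enum-Fin n) (enum-Fin m)) (enum-× (enum-Fin n) (enum-Fin m)))

  arcs : Enumeration Arc
  arcs = enum-⊎ (enum-× (enum-Fin n) (enum-Fin m))
                (enum-⊎ (enum-× (enum-Fin n) (enum-× (enum-Fin n) (enum-Fin m))) (enum-× (enum-Fin n) (enum-Fin m)))

  open Circulation network public using (IsCirculation; NonzeroCirculation; fractional-cycle; reverse)

  flow : Point I → Arc → ℚ
  flow x (give i j)     = xL I x i j
  flow x (trade i i′ j) = x i i′ j
  flow x (take i j)     = xR I x i j

  Balanced : Point I → Set
  Balanced x = ∀ i → Σ[ m ] (xL I x i) ≡ Σ[ m ] (xR I x i)

  flow-circulation : ∀ {x} → Balanced x → IsCirculation (flow x)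
  flow-circulation balanced (agent i)   = sym (balanced i)
  flow-circulation balanced (left i j)  = +-identityʳ _
  flow-circulation balanced (right i j) = sym (+-identityʳ _)

  record FlowFeasible (x : Point I) : Set where
    field
      support  : Support I x
      bounded  : ∀ e → In[0,1] (flow x e)
      balanced : Balanced x

  shift : Point I → (Arc → ℚ) → ℚ → Point I
  shift x c t i i′ j = x i i′ j + t * c (trade i i′ j)

  flow-shift : ∀ x c → IsCirculation c → ∀ t e → flow (shift x c t) e ≡ flow x e + t * c e
  flow-shift x c circ t (give i j)     =
    trans (Σ-+-* n _ _ t) (cong (λ u → xL I x i j + t * u) (trans (sym (circ (left i j))) (+-identityʳ _)))
  flow-shift x c circ t (trade i i′ j) = refl
  flow-shift x c circ t (take i j)     =
    trans (Σ-+-* n _ _ t) (cong (λ u → xR I x i j + t * u) (trans (circ (right i j)) (+-identityʳ _)))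

  Fractional : Point I → Arc → Set
  Fractional x e = ¬ Integral (flow x e)

  fractional? : ∀ x → Decidable (Fractional x)
  fractional? x e = ¬? (integral? (flow x e))

  fractionalCount : Point I → ℕ
  fractionalCount x = length (filter (fractional? x) (proj₁ arcs))

  FixesIntegral : Point I → (Arc → ℚ) → Set
  FixesIntegral x c = ∀ e → c e ≢ 0ℚ → Fractional x e

  shift-fixes-integral : ∀ x c → IsCirculation c → FixesIntegral x c →
                         ∀ t e → Integral (flow x e) → flow (shift x c t) e ≡ flow x e
  shift-fixes-integral x c circ fixes t e int with c e ≟ 0ℚ
  ... | no c≢0  = ⊥-elim (fixes e c≢0 int)
  ... | yes c≡0 = trans (flow-shift x c circ t e) (p+t*0≡p (flow x e) t c≡0)

  shift-feasible : ∀ {x c t} → FlowFeasible x → IsCirculation c → FixesIntegral x c →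
                   (∀ e → Fractional x e → In[0,1] (flow x e + t * c e)) → FlowFeasible (shift x c t)
  shift-feasible {x} {c} {t} fx circ fixes within = record
    { support  = λ i i′ j ¬edge → trans (fixed (trade i i′ j) (subst Integral (sym (support i i′ j ¬edge)) integral-0))
                                        (support i i′ j ¬edge)
    ; bounded  = bounded′
    ; balanced = balanced′
    }
    where
    open FlowFeasible fx
    fixed = shift-fixes-integral x c circ fixes t

    bounded′ : ∀ e → In[0,1] (flow (shift x c t) e)
    bounded′ e with integral? (flow x e)
    ... | yes int = subst In[0,1] (sym (fixed e int)) (bounded e)
    ... | no frac = subst In[0,1] (sym (flow-shift x c circ t e)) (within e frac)

    balanced′ : Balanced (shift x c t)
    balanced′ i = begin
      Σ[ m ] (λ j → flow (shift x c t) (give i j))          ≡⟨ Σ-cong m (λ j → flow-shift x c circ t (give i j)) ⟩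
      Σ[ m ] (λ j → xL I x i j + t * c (give i j))          ≡⟨ Σ-+-* m _ _ t ⟩
      Σ[ m ] (xL I x i) + t * Σ[ m ] (λ j → c (give i j))   ≡⟨ cong₂ (λ p q → p + t * q) (balanced i) (sym (circ (agent i))) ⟩
      Σ[ m ] (xR I x i) + t * Σ[ m ] (λ j → c (take i j))   ≡⟨ sym (Σ-+-* m _ _ t) ⟩
      Σ[ m ] (λ j → xR I x i j + t * c (take i j))          ≡⟨ sym (Σ-cong m (λ j → flow-shift x c circ t (take i j))) ⟩
      Σ[ m ] (λ j → flow (shift x c t) (take i j))          ∎
      where open ≡-Reasoning

  record Step (x : Point I) (c : Arc → ℚ) : Set where
    field
      ε        : ℚ
      ε>0      : 0ℚ < ε
      feasible : FlowFeasible (shift x c ε)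
      fewer    : fractionalCount (shift x c ε) ℕ.< fractionalCount x

  -- Move along c until the first fractional arc becomes integral.
  step : ∀ {x} → FlowFeasible x → (C : NonzeroCirculation (Fractional x)) → Step x (NonzeroCirculation.values C)
  step {x} fx record { values = c ; circulation = circ ; supported = fixes ; nonzero = (e₀ , c₀≢0) } = record
    { ε = ε ; ε>0 = time>0 ; feasible = shift-feasible {t = ε} fx circ fixes within ; fewer = fewer }
    where
    open FlowFeasible fx

    spec : ∀ e → c e ≢ 0ℚ → HitTime (flow x e) (c e) (hitTime (flow x e) (c e))
    spec e c≢0 = let (0<f , f<1) = nonintegral-interior (bounded e) (fixes e c≢0) in hitTime-spec 0<f f<1 c≢0

    open Minimiser (minimiser (λ e → ¬? (c e ≟ 0ℚ)) (λ e → hitTime (flow x e) (c e)) {proj₁ arcs} c₀≢0)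
    open HitTime (spec arg arg-P)

    ε : ℚ
    ε = hitTime (flow x arg) (c arg)

    within : ∀ e → Fractional x e → In[0,1] (flow x e + ε * c e)
    within e frac with c e ≟ 0ℚ
    ... | yes c≡0 = subst In[0,1] (sym (p+t*0≡p (flow x e) ε c≡0)) (bounded e)
    ... | no c≢0  = HitTime.stays (spec e c≢0) ε (<⇒≤ time>0) (minimal (proj₂ arcs e) c≢0)

    fewer : fractionalCount (shift x c ε) ℕ.< fractionalCount x
    fewer = length-filter-mono-< (fractional? x) (fractional? (shift x c ε))
      (λ {e} frac-y int-x → frac-y (subst Integral (sym (shift-fixes-integral x c circ fixes ε e int-x)) int-x))
      (proj₂ arcs arg) (fixes arg arg-P) (λ frac → frac (subst Integral (sym (flow-shift x c circ ε arg)) lands))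

  point-hull : ∀ {x} → Feasible I x → IsIntegralPoint I x → InIntegralHull I x
  point-hull {x} fx int =
    1 , (λ _ → 1ℚ) , (λ _ → x) , (λ _ → <⇒≤ (positive⁻¹ 1ℚ)) , +-identityʳ 1ℚ , (λ _ → fx , int) ,
    (λ i i′ j → sym (trans (+-identityʳ _) (*-identityˡ _)))

  hull-convex : ∀ {s₁ s₂} → 0ℚ ≤ s₁ → 0ℚ ≤ s₂ → s₁ + s₂ ≡ 1ℚ → ∀ {x y₁ y₂} →
                (∀ i i′ j → x i i′ j ≡ s₁ * y₁ i i′ j + s₂ * y₂ i i′ j) →
                InIntegralHull I y₁ → InIntegralHull I y₂ → InIntegralHull I x
  hull-convex {s₁} {s₂} 0≤s₁ 0≤s₂ s₁+s₂≡1 {x} {y₁} {y₂} x≡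
              (k₁ , μ₁ , p₁ , μ₁≥0 , Σμ₁≡1 , p₁-ok , y₁≡) (k₂ , μ₂ , p₂ , μ₂≥0 , Σμ₂≡1 , p₂-ok , y₂≡) =
    k₁ ℕ.+ k₂ , proj₁ ∘ q , proj₂ ∘ q ,
    ++⁺ ((0ℚ ≤_) ∘ proj₁) {xs = q₁} (λ t → 0≤*0≤ 0≤s₁ (μ₁≥0 t)) (λ t → 0≤*0≤ 0≤s₂ (μ₂≥0 t)) ,
    Σμ≡1 ,
    ++⁺ (λ (_ , y) → Feasible I y × IsIntegralPoint I y) {xs = q₁} p₁-ok p₂-ok ,
    x≡Σ
    where
    q₁ : Fin k₁ → ℚ × Point I
    q₁ t = s₁ * μ₁ t , p₁ t
    q₂ : Fin k₂ → ℚ × Point I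
    q₂ t = s₂ * μ₂ t , p₂ t
    q : Fin (k₁ ℕ.+ k₂) → ℚ × Point I
    q = q₁ ++ q₂

    Σμ≡1 : Σ[ k₁ ℕ.+ k₂ ] (proj₁ ∘ q) ≡ 1ℚ
    Σμ≡1 = begin
      Σ[ k₁ ℕ.+ k₂ ] (proj₁ ∘ q)                                 ≡⟨ Σ-∘-++ k₁ proj₁ q₁ q₂ ⟩
      Σ[ k₁ ] (λ t → s₁ * μ₁ t) + Σ[ k₂ ] (λ t → s₂ * μ₂ t)     ≡⟨ cong₂ _+_ (*-distribˡ-Σ k₁ s₁ μ₁) (*-distribˡ-Σ k₂ s₂ μ₂) ⟩
      s₁ * Σ[ k₁ ] μ₁ + s₂ * Σ[ k₂ ] μ₂                          ≡⟨ cong₂ (λ p q → s₁ * p + s₂ * q) Σμ₁≡1 Σμ₂≡1 ⟩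
      s₁ * 1ℚ + s₂ * 1ℚ                                          ≡⟨ trans (cong₂ _+_ (*-identityʳ s₁) (*-identityʳ s₂)) s₁+s₂≡1 ⟩
      1ℚ                                                         ∎
      where open ≡-Reasoning

    scaled : ∀ s {k} (μ : Fin k → ℚ) (p : Fin k → Point I) y →
             (∀ i i′ j → y i i′ j ≡ Σ[ k ] (λ t → μ t * p t i i′ j)) →
             ∀ i i′ j → Σ[ k ] (λ t → s * μ t * p t i i′ j) ≡ s * y i i′ j
    scaled s {k} μ p y y≡ i i′ j =
      trans (Σ-cong k (λ t → *-assoc s (μ t) _)) (trans (*-distribˡ-Σ k s _) (cong (s *_) (sym (y≡ i i′ j))))

    x≡Σ : ∀ i i′ j → x i i′ j ≡ Σ[ k₁ ℕ.+ k₂ ] (λ t → proj₁ (q t) * proj₂ (q t) i i′ j)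
    x≡Σ i i′ j = trans (x≡ i i′ j) (sym (trans (Σ-∘-++ k₁ (λ (w , y) → w * y i i′ j) q₁ q₂)
                   (cong₂ _+_ (scaled s₁ μ₁ p₁ y₁ y₁≡ i i′ j) (scaled s₂ μ₂ p₂ y₂ y₂≡ i i′ j))))

  hull-between : ∀ {x c ε₁ ε₂} → 0ℚ < ε₁ → 0ℚ < ε₂ →
                 InIntegralHull I (shift x c ε₁) → InIntegralHull I (shift x (-_ ∘ c) ε₂) → InIntegralHull I x
  hull-between {x} {c} {ε₁} {ε₂} 0<ε₁ 0<ε₂ =
    hull-convex (0≤*0≤ (<⇒≤ 0<ε₂) 0≤w) (0≤*0≤ (<⇒≤ 0<ε₁) 0≤w) weights≡1 x≡
    where
    0<ε₁+ε₂ : 0ℚ < ε₁ + ε₂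
    0<ε₁+ε₂ = +-mono-< 0<ε₁ 0<ε₂
    instance
      _ = positive 0<ε₁+ε₂
      _ = pos⇒nonZero (ε₁ + ε₂)
    w : ℚ
    w = 1/ (ε₁ + ε₂)
    0≤w : 0ℚ ≤ w
    0≤w = <⇒≤ (positive⁻¹ w {{1/pos⇒pos (ε₁ + ε₂)}})
    weights≡1 : ε₂ * w + ε₁ * w ≡ 1ℚ
    weights≡1 = trans (solve 3 (λ a b w → b :* w :+ a :* w := w :* (a :+ b)) refl ε₁ ε₂ w) (*-inverseˡ (ε₁ + ε₂))
    x≡ : ∀ i i′ j → x i i′ j ≡ ε₂ * w * shift x c ε₁ i i′ j + ε₁ * w * shift x (-_ ∘ c) ε₂ i i′ j
    x≡ i i′ j = sym (trans
      (solve 5 (λ y d a b w → b :* w :* (y :+ a :* d) :+ a :* w :* (y :+ b :* (:- d)) := (w :* (a :+ b)) :* y)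
             refl (x i i′ j) (c (trade i i′ j)) ε₁ ε₂ w)
      (trans (cong (_* x i i′ j) (*-inverseˡ (ε₁ + ε₂))) (*-identityˡ _)))

  module _ (flowFeasible⇒feasible : ∀ {x} → FlowFeasible x → Feasible I x) where

    flowFeasible⇒hull : ∀ N {x} → FlowFeasible x → fractionalCount x ℕ.< N → InIntegralHull I x
    flowFeasible⇒hull (suc N) {x} fx count<N with All.all? (integral? ∘ flow x) (proj₁ arcs)
    ... | yes all-integral =
      point-hull (flowFeasible⇒feasible fx) (λ i i′ j → All.lookup all-integral (proj₂ arcs (trade i i′ j)))
    ... | no some-fractional =
      hull-between {c = NonzeroCirculation.values C} (Step.ε>0 s₁) (Step.ε>0 s₂)
                   (flowFeasible⇒hull N (Step.feasible s₁) (fewer s₁))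
                   (flowFeasible⇒hull N (Step.feasible s₂) (fewer s₂))
      where
      C : NonzeroCirculation (Fractional x)
      C = uncurry (fractional-cycle (flow-circulation (FlowFeasible.balanced fx)))
                  (Any.satisfied (¬All⇒Any¬ (integral? ∘ flow x) _ some-fractional))
      s₁ = step fx C
      s₂ = step fx (reverse C)
      fewer : ∀ {c} (s : Step x c) → fractionalCount (shift x c (Step.ε s)) ℕ.< N
      fewer s = ℕ.<-≤-trans (Step.fewer s) (ℕ.s≤s⁻¹ count<N)

  flow-combination : ∀ {x k} (μ : Fin k → ℚ) (p : Fin k → Point I) →
                     (∀ i i′ j → x i i′ j ≡ Σ[ k ] (λ t → μ t * p t i i′ j)) →
                     ∀ e → flow x e ≡ Σ[ k ] (λ t → μ t * flow (p t) e)
  flow-combination {k = k} μ p x≡ (give i j)     = trans (Σ-cong n (λ i′ → x≡ i i′ j)) (Σ-comm-*ˡ n k μ (λ i′ t → p t i i′ j))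
  flow-combination         μ p x≡ (trade i i′ j) = x≡ i i′ j
  flow-combination {k = k} μ p x≡ (take i′ j)    = trans (Σ-cong n (λ i → x≡ i i′ j)) (Σ-comm-*ˡ n k μ (λ i t → p t i i′ j))

  module _ (feasible⇒flowFeasible : ∀ {x} → Feasible I x → FlowFeasible x) where

    hull⇒flowFeasible : ∀ {x} → InIntegralHull I x → FlowFeasible x
    hull⇒flowFeasible {x} (k , μ , p , μ≥0 , Σμ≡1 , p-ok , x≡) = record
      { support  = λ i i′ j ¬edge → trans (x≡ i i′ j)
                     (trans (Σ-cong k (λ t → trans (cong (μ t *_) (support (fp t) i i′ j ¬edge)) (*-zeroʳ (μ t)))) (Σ-zero k))
      ; bounded  = λ e → subst In[0,1] (sym (flow-combination μ p x≡ e))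
                           (convex-In[0,1] k μ (λ t → flow (p t) e) μ≥0 Σμ≡1 (λ t → bounded (fp t) e))
      ; balanced = balanced′
      }
      where
      open FlowFeasible
      fp : ∀ t → FlowFeasible (p t)
      fp t = feasible⇒flowFeasible (proj₁ (p-ok t))

      balanced′ : Balanced x
      balanced′ i = begin
        Σ[ m ] (xL I x i)                                   ≡⟨ Σ-cong m (λ j → flow-combination μ p x≡ (give i j)) ⟩
        Σ[ m ] (λ j → Σ[ k ] (λ t → μ t * xL I (p t) i j))  ≡⟨ Σ-comm-*ˡ m k μ (λ j t → xL I (p t) i j) ⟩
        Σ[ k ] (λ t → μ t * Σ[ m ] (xL I (p t) i))          ≡⟨ Σ-cong k (λ t → cong (μ t *_) (balanced (fp t) i)) ⟩
        Σ[ k ] (λ t → μ t * Σ[ m ] (xR I (p t) i))          ≡⟨ Σ-comm-*ˡ m k μ (λ j t → xR I (p t) i j) ⟨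
        Σ[ m ] (λ j → Σ[ k ] (λ t → μ t * xR I (p t) i j))  ≡⟨ Σ-cong m (λ j → flow-combination μ p x≡ (take i j)) ⟨
        Σ[ m ] (xR I x i)                                   ∎
        where open ≡-Reasoning

-- Equal item values

module EqualValues {n m : ℕ} (I : BarterSV n m) (equal : AllValuesEqual I) where

  open BarterSV I
  open Network I

  module _ {x : Point I} (support : Support I x) where

    xL-unowned : ∀ i j → ¬ T (have i j) → xL I x i j ≡ 0ℚ
    xL-unowned i j ¬have = trans (Σ-cong n (λ i′ → support i i′ j (¬have ∘ proj₁ ∘ Equivalence.to T-∧))) (Σ-zero n)

    xR-unwanted : ∀ i′ j → ¬ T (wish i′ j) → xR I x i′ j ≡ 0ℚ
    xR-unwanted i′ j ¬wish = trans (Σ-cong n (λ i → support i i′ j (¬wish ∘ proj₂ ∘ Equivalence.to (T-∧ {have i j})))) (Σ-zero n)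

    valueBalanced⇔balanced : ∀ i →
      (Σ[ m ] (λ j → if have i j then xL I x i j * value j else 0ℚ) ≡ Σ[ m ] (λ j → if wish i j then xR I x i j * value j else 0ℚ))
      ⇔ (Σ[ m ] (xL I x i) ≡ Σ[ m ] (xR I x i))
    valueBalanced⇔balanced i = mk⇔
      (λ eq → to (trans (sym (unmask-have)) (trans eq unmask-wish)))
      (λ eq → trans unmask-have (trans (from eq) (sym unmask-wish)))
      where
      open Equivalence (Σ-equally-weighted m value equal value-pos (xL I x i) (xR I x i))
      unmask : ∀ b {q} w → (¬ T b → q ≡ 0ℚ) → (if b then q * w else 0ℚ) ≡ q * w
      unmask true  w _   = refl
      unmask false w q≡0 = sym (trans (cong (_* w) (q≡0 λ ())) (*-zeroˡ w))
      unmask-have : Σ[ m ] (λ j → if have i j then xL I x i j * value j else 0ℚ) ≡ Σ[ m ] (λ j → xL I x i j * value j)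
      unmask-have = Σ-cong m (λ j → unmask (have i j) (value j) (xL-unowned i j))
      unmask-wish : Σ[ m ] (λ j → if wish i j then xR I x i j * value j else 0ℚ) ≡ Σ[ m ] (λ j → xR I x i j * value j)
      unmask-wish = Σ-cong m (λ j → unmask (wish i j) (value j) (xR-unwanted i j))

  feasible⇒flowFeasible : ∀ {x} → Feasible I x → FlowFeasible x
  feasible⇒flowFeasible {x} (support , edge≥0 , have≤1 , wish≤1 , valueBalanced) = record
    { support  = support
    ; bounded  = bounded
    ; balanced = λ i → Equivalence.to (valueBalanced⇔balanced support i) (valueBalanced i)
    }
    where
    trade≥0 : ∀ i i′ j → 0ℚ ≤ x i i′ j
    trade≥0 i i′ j with T? (have i j ∧ wish i′ j)
    ... | yes edge = edge≥0 i i′ j edge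
    ... | no ¬edge = ≤-reflexive (sym (support i i′ j ¬edge))

    give≤1 : ∀ i j → xL I x i j ≤ 1ℚ
    give≤1 i j with T? (have i j)
    ... | yes h = have≤1 i j h
    ... | no ¬h = ≤-trans (≤-reflexive (xL-unowned support i j ¬h)) (<⇒≤ (positive⁻¹ 1ℚ))

    take≤1 : ∀ i′ j → xR I x i′ j ≤ 1ℚ
    take≤1 i′ j with T? (wish i′ j)
    ... | yes w = wish≤1 i′ j w
    ... | no ¬w = ≤-trans (≤-reflexive (xR-unwanted support i′ j ¬w)) (<⇒≤ (positive⁻¹ 1ℚ))

    bounded : ∀ e → In[0,1] (flow x e)
    bounded (give i j)     = Σ-nonNeg n (λ i′ → trade≥0 i i′ j) , give≤1 i j
    bounded (trade i i′ j) = trade≥0 i i′ j , ≤-trans (term≤Σ n (λ t → trade≥0 i t j) i′) (give≤1 i j)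
    bounded (take i′ j)    = Σ-nonNeg n (λ i → trade≥0 i i′ j) , take≤1 i′ j

  flowFeasible⇒feasible : ∀ {x} → FlowFeasible x → Feasible I x
  flowFeasible⇒feasible {x} fx =
    support , (λ i i′ j _ → proj₁ (bounded (trade i i′ j))) , (λ i j _ → proj₂ (bounded (give i j))) ,
    (λ i j _ → proj₂ (bounded (take i j))) , (λ i → Equivalence.from (valueBalanced⇔balanced support i) (balanced i))
    where open FlowFeasible fx

corollary5p10 : ∀ (n m : ℕ) (I : BarterSV n m) → AllValuesEqual I → LPIntegral I
corollary5p10 n m I equal x =
  (λ fx → flowFeasible⇒hull flowFeasible⇒feasible (suc (fractionalCount x)) (feasible⇒flowFeasible fx) (ℕ.n<1+n _)) ,
  flowFeasible⇒feasible ∘ hull⇒flowFeasible feasible⇒flowFeasible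
  where
  open Network I
  open EqualValues I equal
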